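{- Let $n\geq 1$ and $\pi\in\mathcal{S}_n$. If $\pi^2=n\,1\,2\cdots(n-1)$ (in one-line notation, i.e. $\pi^2(1)=n$ and $\pi^2(i)=i-1$ for $2\leq i\leq n$), then $n$ is odd and, writing $m=\frac{n+1}{2}$, \[\pi=m\,(m+1)\cdots(n-1)\,n\,1\,2\cdots(m-1),\] i.e. $\pi(i)=i+m-1$ for $1\leq i\leq m$ and $\pi(i)=i-m$ for $m<i\leq n$.
   Context: $\mathcal{S}_n$ is the symmetric group on $[n]$, permutations written in one-line notation $\pi_1\cdots\pi_n$ with $\pi_i=\pi(i)$; $\pi^2(i)=\pi(\pi(i))$. -}

module Defs where

open import Data.Nat using (ℕ; suc; _∸_; _+_)
open import Data.Nat.DivMod using (_/_)
open import Data.Fin using (Fin; toℕ)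
open import Data.Fin.Permutation using (Permutation′; _⟨$⟩ʳ_)

-- 1-based value of a position/entry: Fin n = {0,…,n-1} ↦ {1,…,n}
val : ∀ {n} → Fin n → ℕ
val i = suc (toℕ i)

sq : ∀ {n} → Permutation′ n → Fin n → Fin n
sq π i = π ⟨$⟩ʳ (π ⟨$⟩ʳ i)

rotTarget : ℕ → ℕ → ℕ
rotTarget n 1 = n
rotTarget n i = i ∸ 1

half : ℕ → ℕ
half n = (n + 1) / 2

{-# OPTIONS --safe #-}
-- π commutes with π² = ρ, the cyclic predecessor on ℤ/n (0-based), so ρ(π(j+1)) = π(j) and
-- induction on j shows that π is the translation x ↦ x + a with a = π(0). Then
-- ρ(0) = π²(0) = 2a mod n; since 0 ≤ 2a ≤ 2n − 2 this forces 2a = n − 1, so n = 2a + 1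
-- and m = a + 1.
module Submission where

open import Defs
open import Data.Nat using (ℕ; zero; suc; _+_; _*_; _∸_; _≤_; _>_; _<_; NonZero; s≤s; z<s)
open import Data.Nat.Properties
open import Data.Nat.DivMod using (_%_; _/_; m*n/n≡m; m%n<n; m<n⇒m%n≡m; m≤n⇒m%n≡m;
  m≤n⇒[n∸m]%m≡n%m; %-pred-≡0; m<[1+n%d]⇒m≤[n%d]; [1+m%d]≤1+n⇒[m%d]≤n)
open import Data.Fin using (Fin; toℕ; zero)
open import Data.Fin.Properties using (toℕ<n)
open import Data.Fin.Permutation using (Permutation′; _⟨$⟩ʳ_)
open import Data.Product using (_×_; ∃-syntax; _,_)
open import Relation.Nullary using (yes; no; contradiction)
open import Relation.Binary.PropositionalEquality

m%n≡m∸n : ∀ {m n} .{{_ : NonZero n}} → n ≤ m → m < n + n → m % n ≡ m ∸ n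
m%n≡m∸n {m} {n} n≤m m<n+n = begin
  m % n       ≡⟨ m≤n⇒[n∸m]%m≡n%m n≤m ⟨
  (m ∸ n) % n ≡⟨ m<n⇒m%n≡m (m<n+o⇒m∸n<o m n m<n+n) ⟩
  m ∸ n       ∎
  where open ≡-Reasoning

[m+m]%[1+n]≡n⇒n≡m+m : ∀ {m n} → m < suc n → (m + m) % suc n ≡ n → n ≡ m + m
[m+m]%[1+n]≡n⇒n≡m+m {m} {n} m<1+n eq with m + m ≤? n
... | yes m+m≤n = trans (sym eq) (m≤n⇒m%n≡m m+m≤n)
... | no  m+m≰n = contradiction (+-mono-≤ m≤n m≤n) (<⇒≱ (≤-reflexive (sym m+m≡1+n+n)))
  where
  m≤n : m ≤ n
  m≤n = ≤-pred m<1+n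
  m+m≡1+n+n : m + m ≡ suc (n + n)
  m+m≡1+n+n = begin
    m + m                   ≡⟨ m∸n+n≡m (≰⇒> m+m≰n) ⟨
    (m + m ∸ suc n) + suc n ≡⟨ cong (_+ suc n) (trans (sym (m%n≡m∸n (≰⇒> m+m≰n) (+-mono-< m<1+n m<1+n))) eq) ⟩
    n + suc n               ≡⟨ +-suc n n ⟩
    suc (n + n)             ∎
    where open ≡-Reasoning

half-odd : ∀ k → half (1 + 2 * k) ≡ suc k
half-odd k = trans (cong (_/ 2) 1+2k+1≡[1+k]*2) (m*n/n≡m (suc k) 2)
  where
  1+2k+1≡[1+k]*2 : 1 + 2 * k + 1 ≡ suc k * 2
  1+2k+1≡[1+k]*2 = trans (+-comm (1 + 2 * k) 1) (trans (sym (*-suc 2 k)) (*-comm 2 (suc k)))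

cyclicPred : ℕ → ℕ → ℕ
cyclicPred n zero    = n
cyclicPred n (suc x) = x

rotTarget-suc : ∀ n x → rotTarget (suc n) (suc x) ≡ suc (cyclicPred n x)
rotTarget-suc n zero    = refl
rotTarget-suc n (suc x) = refl

cyclicPred-injective : ∀ {n x y} → x < suc n → y < suc n → cyclicPred n x ≡ cyclicPred n y → x ≡ y
cyclicPred-injective {x = zero}  {zero}  _         _         _  = refl
cyclicPred-injective {x = zero}  {suc y} _         (s≤s y<n) eq = contradiction y<n (<-irrefl (sym eq))
cyclicPred-injective {x = suc x} {zero}  (s≤s x<n) _         eq = contradiction x<n (<-irrefl eq)
cyclicPred-injective {x = suc x} {suc y} _         _         eq = cong suc eq

cyclicPred-suc% : ∀ n x → cyclicPred n (suc x % suc n) ≡ x % suc n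
cyclicPred-suc% n x with suc x % suc n in eq
... | zero  = sym (%-pred-≡0 eq)
... | suc r = ≤-antisym
  (m<[1+n%d]⇒m≤[n%d] x (suc n) (≤-reflexive (sym eq)))
  ([1+m%d]≤1+n⇒[m%d]≤n x r (suc n) (subst (0 <_) (sym eq) z<s) (≤-reflexive eq))

module SquareRootOfCyclicPred {n : ℕ} (π : Permutation′ (suc n))
  (sq≡pred : ∀ i → toℕ (sq π i) ≡ cyclicPred n (toℕ i)) where

  shift : ℕ
  shift = toℕ (π ⟨$⟩ʳ zero)

  -- π (sq π i) and sq π (π i) are the same element π³(i): π commutes with cyclicPred.
  toℕ-π : ∀ i → toℕ (π ⟨$⟩ʳ i) ≡ (shift + toℕ i) % suc n
  toℕ-π i = go (toℕ i) i refl
    where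
    open ≡-Reasoning
    go : ∀ j i → toℕ i ≡ j → toℕ (π ⟨$⟩ʳ i) ≡ (shift + j) % suc n
    go zero    zero _  = sym (trans (cong (_% suc n) (+-identityʳ shift)) (m<n⇒m%n≡m (toℕ<n (π ⟨$⟩ʳ zero))))
    go (suc j) i    i≡ = cyclicPred-injective (toℕ<n (π ⟨$⟩ʳ i)) (m%n<n (shift + suc j) (suc n)) (begin
      cyclicPred n (toℕ (π ⟨$⟩ʳ i))          ≡⟨ sq≡pred (π ⟨$⟩ʳ i) ⟨
      toℕ (π ⟨$⟩ʳ (sq π i))                  ≡⟨ go j (sq π i) (trans (sq≡pred i) (cong (cyclicPred n) i≡)) ⟩
      (shift + j) % suc n                    ≡⟨ cyclicPred-suc% n (shift + j) ⟨
      cyclicPred n (suc (shift + j) % suc n) ≡⟨ cong (λ k → cyclicPred n (k % suc n)) (+-suc shift j) ⟨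
      cyclicPred n ((shift + suc j) % suc n) ∎)

  n≡shift+shift : n ≡ shift + shift
  n≡shift+shift = [m+m]%[1+n]≡n⇒n≡m+m (toℕ<n (π ⟨$⟩ʳ zero))
    (trans (sym (toℕ-π (π ⟨$⟩ʳ zero))) (sq≡pred zero))

  toℕ-π-≤ : ∀ i → toℕ i ≤ shift → toℕ (π ⟨$⟩ʳ i) ≡ toℕ i + shift
  toℕ-π-≤ i i≤shift = begin
    toℕ (π ⟨$⟩ʳ i)          ≡⟨ toℕ-π i ⟩
    (shift + toℕ i) % suc n ≡⟨ m≤n⇒m%n≡m (subst (shift + toℕ i ≤_) (sym n≡shift+shift) (+-monoʳ-≤ shift i≤shift)) ⟩
    shift + toℕ i           ≡⟨ +-comm shift (toℕ i) ⟩
    toℕ i + shift           ∎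
    where open ≡-Reasoning

  toℕ-π-> : ∀ i → shift < toℕ i → suc (toℕ (π ⟨$⟩ʳ i)) ≡ toℕ i ∸ shift
  toℕ-π-> i shift<i = begin
    suc (toℕ (π ⟨$⟩ʳ i))                      ≡⟨ cong suc (toℕ-π i) ⟩
    suc ((shift + toℕ i) % suc n)             ≡⟨ cong suc (m%n≡m∸n 1+n≤ (+-mono-< (toℕ<n (π ⟨$⟩ʳ zero)) (toℕ<n i))) ⟩
    suc (shift + toℕ i ∸ suc n)               ≡⟨ cong (λ k → suc (shift + toℕ i ∸ suc k)) n≡shift+shift ⟩
    suc (shift + toℕ i ∸ suc (shift + shift)) ≡⟨ cong (λ k → suc (shift + toℕ i ∸ k)) (+-suc shift shift) ⟨
    suc (shift + toℕ i ∸ (shift + suc shift)) ≡⟨ cong suc ([m+n]∸[m+o]≡n∸o shift (toℕ i) (suc shift)) ⟩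
    suc (toℕ i ∸ suc shift)                   ≡⟨ +-∸-assoc 1 shift<i ⟨
    toℕ i ∸ shift                             ∎
    where
    open ≡-Reasoning
    1+n≤ : suc n ≤ shift + toℕ i
    1+n≤ = subst (_< shift + toℕ i) (sym n≡shift+shift) (+-monoʳ-< shift shift<i)

lemma4p1 : (n : ℕ) → 1 ≤ n → (π : Permutation′ n)
    → (∀ (i : Fin n) → val (sq π i) ≡ rotTarget n (val i))
    → (∃[ k ] n ≡ 1 + 2 * k)
      × (∀ (i : Fin n) → (val i ≤ half n → val (π ⟨$⟩ʳ i) ≡ val i + half n ∸ 1)
                       × (val i > half n → val (π ⟨$⟩ʳ i) ≡ val i ∸ half n))
lemma4p1 zero    () _ _
lemma4p1 (suc n) _  π sq≡rot = (shift , 1+n≡1+2shift) , λ i → lower i , upper i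
  where
  open SquareRootOfCyclicPred π (λ i → suc-injective (trans (sq≡rot i) (rotTarget-suc n (toℕ i))))
  1+n≡1+2shift : suc n ≡ 1 + 2 * shift
  1+n≡1+2shift = cong suc (trans n≡shift+shift (cong (shift +_) (sym (+-identityʳ shift))))
  half≡ : half (suc n) ≡ suc shift
  half≡ = trans (cong half 1+n≡1+2shift) (half-odd shift)
  lower : ∀ i → val i ≤ half (suc n) → val (π ⟨$⟩ʳ i) ≡ val i + half (suc n) ∸ 1
  lower i rewrite half≡ = λ { (s≤s i≤shift) → trans (cong suc (toℕ-π-≤ i i≤shift)) (sym (+-suc (toℕ i) shift)) }
  upper : ∀ i → val i > half (suc n) → val (π ⟨$⟩ʳ i) ≡ val i ∸ half (suc n)
  upper i rewrite half≡ = λ { (s≤s shift<i) → toℕ-π-> i shift<i }
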